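{- Let $q$ be a prime power and $n\ge1$. Let $G=\mathbb F_q(\theta)^*/(\mathbb F_q(\theta)^*)^{q-1}$, fix a generator $g$ of $\mathbb F_q^*$, and let $\phi:G\to(\mathbb Z/(q-1))^2$ be the homomorphism sending the class of $f\in\mathbb F_q(\theta)^*$ to $(e\bmod (q-1),\ \deg f\bmod (q-1))$, where $g^e$ is the leading coefficient of $f$ (ratio of leading coefficients of numerator and denominator) and $\deg f$ is the degree of the numerator minus that of the denominator. Then the set of classes in $G$ of polynomials $P=\sum_{i=0}^m a_i\theta^i\in\mathbb F_q[\theta]$ with $m\equiv -n\pmod{q-1}$ and $a_m=(-1)^n$ equals $\phi^{ -1}\big((n\tfrac{q-1}{2},\,-n)\big)$ if $q$ is odd and $\phi^{ -1}\big((0,\,-n)\big)$ if $q$ is even; in particular it is a coset of a subgroup of index $(q-1)^2$ in $G$.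
   Context: $G$ parametrizes the twists $\mathfrak C^n_P$ (Anderson T-motives with $\tau e=P(\theta)(T-\theta)^ne$) up to isomorphism over $\mathbb F_q(\theta)$; it is a free $\mathbb Z/(q-1)$-module with basis the class of $g$ together with the classes of the monic irreducible polynomials $\mathfrak Q$, and $\phi$ sends the class of $g$ to $(1,0)$ and the class of $\mathfrak Q$ to $(0,\deg\mathfrak Q)$. -}

module Defs where

open import Level using (0ℓ)
open import Algebra.Bundles using (CommutativeRing)
open import Data.Nat as ℕ using (ℕ; zero; suc)
open import Data.Nat.Primality using (Prime)
open import Data.Integer as ℤ using (ℤ; +_)
open import Data.Integer.Divisibility using () renaming (_∣_ to _∣ℤ_)
open import Data.List using (List; []; _∷_; _++_; [_])
open import Data.Vec using (Vec; toList)
open import Data.Product using (Σ; ∃; ∃-syntax; _×_; _,_)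
open import Relation.Nullary using (¬_)
open import Relation.Binary.PropositionalEquality using (_≡_)

IsPrimePower : ℕ → Set
IsPrimePower q = ∃[ p ] ∃[ k ] (Prime p × 1 ℕ.≤ k × q ≡ p ℕ.^ k)

_≡_[mod_] : ℤ → ℤ → ℕ → Set
x ≡ y [mod m ] = (+ m) ∣ℤ (x ℤ.- y)

module Over (R : CommutativeRing 0ℓ 0ℓ) where
  open CommutativeRing R

  IsField : Set
  IsField = ¬ (1# ≈ 0#) × (∀ x → ¬ (x ≈ 0#) → ∃[ y ] (x * y ≈ 1#))

  pow : Carrier → ℕ → Carrier
  pow x zero = 1#
  pow x (suc n) = x * pow x n

  -- polynomials in θ: coefficient lists, lowest degree first
  Poly : Set
  Poly = List Carrier

  -- equality of polynomials (lists equal up to trailing zeros)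
  data _≈ₚ_ : Poly → Poly → Set where
    []≈[] : [] ≈ₚ []
    ∷≈∷  : ∀ {x y p q} → x ≈ y → p ≈ₚ q → (x ∷ p) ≈ₚ (y ∷ q)
    []≈∷ : ∀ {y q} → y ≈ 0# → [] ≈ₚ q → [] ≈ₚ (y ∷ q)
    ∷≈[] : ∀ {x p} → x ≈ 0# → p ≈ₚ [] → (x ∷ p) ≈ₚ []

  infixl 6 _+ₚ_
  infixl 7 _*ₚ_ _·ₚ_

  _+ₚ_ : Poly → Poly → Poly
  [] +ₚ q = q
  (x ∷ p) +ₚ [] = x ∷ p
  (x ∷ p) +ₚ (y ∷ q) = (x + y) ∷ (p +ₚ q)

  _·ₚ_ : Carrier → Poly → Poly
  c ·ₚ [] = []
  c ·ₚ (x ∷ p) = (c * x) ∷ (c ·ₚ p)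

  _*ₚ_ : Poly → Poly → Poly
  [] *ₚ q = []
  (a ∷ p) *ₚ q = (a ·ₚ q) +ₚ (0# ∷ (p *ₚ q))

  powₚ : Poly → ℕ → Poly
  powₚ p zero = [ 1# ]
  powₚ p (suc n) = p *ₚ powₚ p n

  -- P = a₀ + … + a_m θ^m with a_m = c ≠ 0 : degree m, leading coefficient c
  HasLead : Poly → ℕ → Carrier → Set
  HasLead P m c = ¬ (c ≈ 0#) × Σ (Vec Carrier m) (λ v → P ≈ₚ (toList v ++ [ c ]))

  NonZeroPoly : Poly → Set
  NonZeroPoly P = ¬ (P ≈ₚ [])

  -- elements of 𝔽_q(θ)^* : num / den with num, den nonzero polynomials
  record RatFun : Set where
    field
      num : Poly
      den : Poly
      num≠0 : NonZeroPoly num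
      den≠0 : NonZeroPoly den
  open RatFun public

  -- f and h have the same class in G = 𝔽_q(θ)^* / (𝔽_q(θ)^*)^(q-1):
  -- f = h · u^(q-1) for some u ∈ 𝔽_q(θ)^*
  SameClass : ℕ → RatFun → RatFun → Set
  SameClass q f h = Σ RatFun λ u →
    ((num f *ₚ den h *ₚ powₚ (den u) (q ℕ.∸ 1))
      ≈ₚ (num h *ₚ den f *ₚ powₚ (num u) (q ℕ.∸ 1)))

  SameClassPoly : ℕ → RatFun → Poly → Set
  SameClassPoly q f P = Σ RatFun λ u →
    ((num f *ₚ powₚ (den u) (q ℕ.∸ 1))
      ≈ₚ (P *ₚ den f *ₚ powₚ (num u) (q ℕ.∸ 1)))

  -- φ(class of f) = (a mod q-1, b mod q-1), where g is the chosen generator: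
  -- leading coeff of f is g^e with e ≡ a, deg num - deg den ≡ b (mod q-1)
  PhiIs : ℕ → Carrier → RatFun → ℤ → ℤ → Set
  PhiIs q g f a b = ∃[ m₁ ] ∃[ m₂ ] ∃[ c₁ ] ∃[ c₂ ] ∃[ e ]
    ( HasLead (num f) m₁ c₁ × HasLead (den f) m₂ c₂
    × c₁ ≈ pow g e * c₂
    × (+ e) ≡ a [mod (q ℕ.∸ 1) ]
    × ((+ m₁) ℤ.- (+ m₂)) ≡ b [mod (q ℕ.∸ 1) ] )

  InSpecialSet : ℕ → ℕ → RatFun → Set
  InSpecialSet q n f = ∃[ P ] ∃[ m ]
    ( HasLead P m (pow (- 1#) n)
    × (+ m) ≡ ℤ.- (+ n) [mod (q ℕ.∸ 1) ]
    × SameClassPoly q f P )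

-- Clearing denominators, f = P · u^(q−1) reads num f · (den u)^(q−1) = P · den f · (num u)^(q−1)
-- in 𝔽_q[θ]. Leading terms are multiplicative and every nonzero c ∈ 𝔽_q satisfies c^(q−1) = 1
-- (g generates 𝔽_q^* and has order q − 1), so comparing leading terms shows that such an f has
-- leading-coefficient ratio (−1)^n and degree ≡ deg P ≡ −n mod q − 1. Conversely, if φ(f) has
-- these values, then P = num f · (den f)^(q−2) has leading coefficient (−1)^n and degree ≡ −n,
-- and f = P · (1 / den f)^(q−1). It remains to write (−1)^n as a power of g: for odd q,
-- g^((q−1)/2) is a square root of 1 other than 1, hence −1; for even q, q − 1 is odd, so
-- −1 = (−1)^(q−1) = 1. Surjectivity of φ is witnessed by g^e θ^m₁ / θ^m₂.

{-# OPTIONS --safe #-}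
module Submission where

open import Defs
open import Level using (0ℓ)
open import Algebra.Bundles using (CommutativeRing)
import Algebra.Properties.CommutativeSemigroup as CommutativeSemigroupProperties
import Algebra.Properties.Group as GroupProperties
import Algebra.Properties.Semiring.Exp as SemiringExp
open import Data.Nat as ℕ using (ℕ; zero; suc; _≤_; _<_; z≤n; s≤s)
import Data.Nat.Properties as ℕ
open import Data.Nat.Divisibility using (_∣_; divides)
open import Data.Nat.DivMod using (_%_; _/_; m≡m%n+[m/n]*n; m%n<n; m*n/n≡m)
open import Data.Integer as ℤ using (ℤ; +_; -[1+_])
import Data.Integer.Properties as ℤ
import Data.Integer.Divisibility.Signed as Signed
open import Data.Integer.DivMod using (_%ℕ_; _/ℕ_; a≡a%ℕn+[a/ℕn]*n; n%ℕd<d)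
open import Data.Integer.Tactic.RingSolver using (solve-∀)
open import Data.List using ([]; _∷_; _++_; [_]; length)
open import Data.List.Properties using (length-++)
open import Data.Vec as Vec using (toList; fromList)
open import Data.Vec.Properties using (length-toList; toList∘fromList)
open import Data.Fin as Fin using (Fin; toℕ; punchIn; punchOut; fromℕ<)
import Data.Fin.Properties as Fin
open import Data.Product using (∃-syntax; _×_; _,_; proj₁; proj₂)
open import Data.Sum using (_⊎_; inj₁; inj₂)
open import Data.Empty using (⊥-elim)
open import Function.Bundles using (Bijection; Inverse; _⇔_; mk⇔)
open import Function.Properties.Bijection using (Bijection⇒Inverse)
open import Relation.Nullary using (¬_; Dec; yes; no)
open import Relation.Nullary.Decidable using (map′)
open import Relation.Binary.Bundles using (Setoid)
open import Relation.Binary.Structures using (IsEquivalence)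
open import Relation.Binary.Definitions using (Decidable)
open import Relation.Binary.PropositionalEquality as ≡ using (_≡_)
import Relation.Binary.Reasoning.Setoid as SetoidReasoning

module Polynomials (R : CommutativeRing 0ℓ 0ℓ) where
  open CommutativeRing R hiding (zero)
  open Over R
  open CommutativeSemigroupProperties +-commutativeSemigroup using () renaming (interchange to +-interchange)

  coeff : Poly → ℕ → Carrier
  coeff []      _       = 0#
  coeff (x ∷ p) zero    = x
  coeff (x ∷ p) (suc i) = coeff p i

  infix 4 _≈ᶜ_

  _≈ᶜ_ : Poly → Poly → Set
  A ≈ᶜ B = ∀ i → coeff A i ≈ coeff B i

  ≈ₚ⇒≈ᶜ : ∀ {A B} → A ≈ₚ B → A ≈ᶜ B
  ≈ₚ⇒≈ᶜ []≈[]       i       = refl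
  ≈ₚ⇒≈ᶜ (∷≈∷ x≈y _) zero    = x≈y
  ≈ₚ⇒≈ᶜ (∷≈∷ _ p≈q) (suc i) = ≈ₚ⇒≈ᶜ p≈q i
  ≈ₚ⇒≈ᶜ ([]≈∷ y≈0 _) zero   = sym y≈0
  ≈ₚ⇒≈ᶜ ([]≈∷ _ e)  (suc i) = ≈ₚ⇒≈ᶜ e i
  ≈ₚ⇒≈ᶜ (∷≈[] x≈0 _) zero   = x≈0
  ≈ₚ⇒≈ᶜ (∷≈[] _ e)  (suc i) = ≈ₚ⇒≈ᶜ e i

  ≈ᶜ⇒≈ₚ : ∀ {A B} → A ≈ᶜ B → A ≈ₚ B
  ≈ᶜ⇒≈ₚ {[]}    {[]}    e = []≈[]
  ≈ᶜ⇒≈ₚ {[]}    {y ∷ B} e = []≈∷ (sym (e zero)) (≈ᶜ⇒≈ₚ (λ i → e (suc i)))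
  ≈ᶜ⇒≈ₚ {x ∷ A} {[]}    e = ∷≈[] (e zero) (≈ᶜ⇒≈ₚ (λ i → e (suc i)))
  ≈ᶜ⇒≈ₚ {x ∷ A} {y ∷ B} e = ∷≈∷ (e zero) (≈ᶜ⇒≈ₚ (λ i → e (suc i)))

  ≈ₚ-isEquivalence : IsEquivalence _≈ₚ_
  ≈ₚ-isEquivalence = record
    { refl  = ≈ᶜ⇒≈ₚ (λ _ → refl)
    ; sym   = λ e → ≈ᶜ⇒≈ₚ (λ i → sym (≈ₚ⇒≈ᶜ e i))
    ; trans = λ e f → ≈ᶜ⇒≈ₚ (λ i → trans (≈ₚ⇒≈ᶜ e i) (≈ₚ⇒≈ᶜ f i))
    }

  ≈ₚ-setoid : Setoid 0ℓ 0ℓ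
  ≈ₚ-setoid = record { isEquivalence = ≈ₚ-isEquivalence }

  open Setoid ≈ₚ-setoid public
    using () renaming (refl to ≈ₚ-refl; sym to ≈ₚ-sym; trans to ≈ₚ-trans)
  module ≈ₚ-Reasoning = SetoidReasoning ≈ₚ-setoid

  module _ where
    open SetoidReasoning setoid

    coeff-+ₚ : ∀ A B i → coeff (A +ₚ B) i ≈ coeff A i + coeff B i
    coeff-+ₚ []      B       i       = sym (+-identityˡ _)
    coeff-+ₚ (x ∷ A) []      zero    = sym (+-identityʳ _)
    coeff-+ₚ (x ∷ A) []      (suc i) = sym (+-identityʳ _)
    coeff-+ₚ (x ∷ A) (y ∷ B) zero    = refl
    coeff-+ₚ (x ∷ A) (y ∷ B) (suc i) = coeff-+ₚ A B i

    coeff-·ₚ : ∀ a A i → coeff (a ·ₚ A) i ≈ a * coeff A i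
    coeff-·ₚ a []      i       = sym (zeroʳ a)
    coeff-·ₚ a (x ∷ A) zero    = refl
    coeff-·ₚ a (x ∷ A) (suc i) = coeff-·ₚ a A i

    +ₚ-cong : ∀ {A A′ B B′} → A ≈ₚ A′ → B ≈ₚ B′ → (A +ₚ B) ≈ₚ (A′ +ₚ B′)
    +ₚ-cong {A} {A′} {B} {B′} e f = ≈ᶜ⇒≈ₚ λ i → begin
      coeff (A +ₚ B) i          ≈⟨ coeff-+ₚ A B i ⟩
      coeff A i + coeff B i     ≈⟨ +-cong (≈ₚ⇒≈ᶜ e i) (≈ₚ⇒≈ᶜ f i) ⟩
      coeff A′ i + coeff B′ i   ≈⟨ coeff-+ₚ A′ B′ i ⟨
      coeff (A′ +ₚ B′) i        ∎

    ·ₚ-cong : ∀ {a a′ A A′} → a ≈ a′ → A ≈ₚ A′ → (a ·ₚ A) ≈ₚ (a′ ·ₚ A′)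
    ·ₚ-cong {a} {a′} {A} {A′} e f = ≈ᶜ⇒≈ₚ λ i → begin
      coeff (a ·ₚ A) i   ≈⟨ coeff-·ₚ a A i ⟩
      a * coeff A i      ≈⟨ *-cong e (≈ₚ⇒≈ᶜ f i) ⟩
      a′ * coeff A′ i    ≈⟨ coeff-·ₚ a′ A′ i ⟨
      coeff (a′ ·ₚ A′) i ∎

    ·ₚ-zeroˡ : ∀ {a} B → a ≈ 0# → (a ·ₚ B) ≈ₚ []
    ·ₚ-zeroˡ {a} B a≈0 = ≈ᶜ⇒≈ₚ λ i → begin
      coeff (a ·ₚ B) i ≈⟨ coeff-·ₚ a B i ⟩
      a * coeff B i    ≈⟨ *-congʳ a≈0 ⟩
      0# * coeff B i   ≈⟨ zeroˡ _ ⟩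
      0#               ∎

    ·ₚ-distribˡ-+ₚ : ∀ a A B → (a ·ₚ (A +ₚ B)) ≈ₚ (a ·ₚ A +ₚ a ·ₚ B)
    ·ₚ-distribˡ-+ₚ a A B = ≈ᶜ⇒≈ₚ λ i → begin
      coeff (a ·ₚ (A +ₚ B)) i               ≈⟨ coeff-·ₚ a (A +ₚ B) i ⟩
      a * coeff (A +ₚ B) i                  ≈⟨ *-congˡ (coeff-+ₚ A B i) ⟩
      a * (coeff A i + coeff B i)           ≈⟨ distribˡ a _ _ ⟩
      a * coeff A i + a * coeff B i         ≈⟨ +-cong (coeff-·ₚ a A i) (coeff-·ₚ a B i) ⟨
      coeff (a ·ₚ A) i + coeff (a ·ₚ B) i   ≈⟨ coeff-+ₚ (a ·ₚ A) (a ·ₚ B) i ⟨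
      coeff (a ·ₚ A +ₚ a ·ₚ B) i            ∎

    ·ₚ-distribʳ-+ : ∀ a b A → ((a + b) ·ₚ A) ≈ₚ (a ·ₚ A +ₚ b ·ₚ A)
    ·ₚ-distribʳ-+ a b A = ≈ᶜ⇒≈ₚ λ i → begin
      coeff ((a + b) ·ₚ A) i                ≈⟨ coeff-·ₚ (a + b) A i ⟩
      (a + b) * coeff A i                   ≈⟨ distribʳ _ a b ⟩
      a * coeff A i + b * coeff A i         ≈⟨ +-cong (coeff-·ₚ a A i) (coeff-·ₚ b A i) ⟨
      coeff (a ·ₚ A) i + coeff (b ·ₚ A) i   ≈⟨ coeff-+ₚ (a ·ₚ A) (b ·ₚ A) i ⟨
      coeff (a ·ₚ A +ₚ b ·ₚ A) i            ∎

    ·ₚ-assoc : ∀ a b A → (a ·ₚ (b ·ₚ A)) ≈ₚ ((a * b) ·ₚ A)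
    ·ₚ-assoc a b A = ≈ᶜ⇒≈ₚ λ i → begin
      coeff (a ·ₚ (b ·ₚ A)) i ≈⟨ coeff-·ₚ a (b ·ₚ A) i ⟩
      a * coeff (b ·ₚ A) i    ≈⟨ *-congˡ (coeff-·ₚ b A i) ⟩
      a * (b * coeff A i)     ≈⟨ *-assoc _ _ _ ⟨
      (a * b) * coeff A i     ≈⟨ coeff-·ₚ (a * b) A i ⟨
      coeff ((a * b) ·ₚ A) i  ∎

    ·ₚ-identityˡ : ∀ A → (1# ·ₚ A) ≈ₚ A
    ·ₚ-identityˡ A = ≈ᶜ⇒≈ₚ λ i → trans (coeff-·ₚ 1# A i) (*-identityˡ _)

    +ₚ-identityʳ : ∀ A → (A +ₚ []) ≈ₚ A
    +ₚ-identityʳ []      = ≈ₚ-refl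
    +ₚ-identityʳ (x ∷ A) = ≈ₚ-refl

    +ₚ-interchange : ∀ A B C D → ((A +ₚ B) +ₚ (C +ₚ D)) ≈ₚ ((A +ₚ C) +ₚ (B +ₚ D))
    +ₚ-interchange A B C D = ≈ᶜ⇒≈ₚ λ i → begin
      coeff ((A +ₚ B) +ₚ (C +ₚ D)) i                       ≈⟨ coeff-+ₚ (A +ₚ B) (C +ₚ D) i ⟩
      coeff (A +ₚ B) i + coeff (C +ₚ D) i                  ≈⟨ +-cong (coeff-+ₚ A B i) (coeff-+ₚ C D i) ⟩
      (coeff A i + coeff B i) + (coeff C i + coeff D i)    ≈⟨ +-interchange _ _ _ _ ⟩
      (coeff A i + coeff C i) + (coeff B i + coeff D i)    ≈⟨ +-cong (coeff-+ₚ A C i) (coeff-+ₚ B D i) ⟨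
      coeff (A +ₚ C) i + coeff (B +ₚ D) i                  ≈⟨ coeff-+ₚ (A +ₚ C) (B +ₚ D) i ⟨
      coeff ((A +ₚ C) +ₚ (B +ₚ D)) i                       ∎

  module _ where
    open ≈ₚ-Reasoning

    *ₚ-congʳ : ∀ A {B B′} → B ≈ₚ B′ → (A *ₚ B) ≈ₚ (A *ₚ B′)
    *ₚ-congʳ []      e = []≈[]
    *ₚ-congʳ (a ∷ A) e = +ₚ-cong (·ₚ-cong refl e) (∷≈∷ refl (*ₚ-congʳ A e))

    *ₚ-congˡ : ∀ {A A′} B → A ≈ₚ A′ → (A *ₚ B) ≈ₚ (A′ *ₚ B)
    *ₚ-congˡ B []≈[]          = []≈[]
    *ₚ-congˡ B (∷≈∷ x≈y e)    = +ₚ-cong (·ₚ-cong x≈y ≈ₚ-refl) (∷≈∷ refl (*ₚ-congˡ B e))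
    *ₚ-congˡ B ([]≈∷ y≈0 e)   = ≈ₚ-sym (+ₚ-cong (·ₚ-zeroˡ B y≈0) (∷≈[] refl (≈ₚ-sym (*ₚ-congˡ B e))))
    *ₚ-congˡ B (∷≈[] x≈0 e)   = +ₚ-cong (·ₚ-zeroˡ B x≈0) (∷≈[] refl (*ₚ-congˡ B e))

    *ₚ-zeroʳ : ∀ A → (A *ₚ []) ≈ₚ []
    *ₚ-zeroʳ []      = []≈[]
    *ₚ-zeroʳ (x ∷ A) = ∷≈[] refl (*ₚ-zeroʳ A)

    *ₚ-identityˡ : ∀ A → ([ 1# ] *ₚ A) ≈ₚ A
    *ₚ-identityˡ A = begin
      1# ·ₚ A +ₚ [ 0# ] ≈⟨ +ₚ-cong ≈ₚ-refl (∷≈[] refl []≈[]) ⟩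
      1# ·ₚ A +ₚ []      ≈⟨ +ₚ-identityʳ _ ⟩
      1# ·ₚ A            ≈⟨ ·ₚ-identityˡ A ⟩
      A                  ∎

    *ₚ-identityʳ : ∀ A → (A *ₚ [ 1# ]) ≈ₚ A
    *ₚ-identityʳ []      = []≈[]
    *ₚ-identityʳ (x ∷ A) = ∷≈∷ (trans (+-identityʳ _) (*-identityʳ x)) (*ₚ-identityʳ A)

    *ₚ-shiftˡ : ∀ A C → ((0# ∷ A) *ₚ C) ≈ₚ (0# ∷ (A *ₚ C))
    *ₚ-shiftˡ A C = +ₚ-cong (·ₚ-zeroˡ C refl) ≈ₚ-refl

    *ₚ-shiftʳ : ∀ A C → (A *ₚ (0# ∷ C)) ≈ₚ (0# ∷ (A *ₚ C))
    *ₚ-shiftʳ []      C = []≈∷ refl []≈[]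
    *ₚ-shiftʳ (x ∷ A) C = ∷≈∷ (trans (+-identityʳ _) (zeroʳ x)) (+ₚ-cong ≈ₚ-refl (*ₚ-shiftʳ A C))

    ·ₚ-shift : ∀ a A → (a ·ₚ (0# ∷ A)) ≈ₚ (0# ∷ (a ·ₚ A))
    ·ₚ-shift a A = ∷≈∷ (zeroʳ a) ≈ₚ-refl

    *ₚ-·ₚ-assoc : ∀ a A C → ((a ·ₚ A) *ₚ C) ≈ₚ (a ·ₚ (A *ₚ C))
    *ₚ-·ₚ-assoc a []      C = []≈[]
    *ₚ-·ₚ-assoc a (x ∷ A) C = begin
      (a * x) ·ₚ C +ₚ (0# ∷ ((a ·ₚ A) *ₚ C))    ≈⟨ +ₚ-cong (≈ₚ-sym (·ₚ-assoc a x C)) (∷≈∷ refl (*ₚ-·ₚ-assoc a A C)) ⟩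
      a ·ₚ (x ·ₚ C) +ₚ (0# ∷ (a ·ₚ (A *ₚ C)))   ≈⟨ +ₚ-cong ≈ₚ-refl (·ₚ-shift a (A *ₚ C)) ⟨
      a ·ₚ (x ·ₚ C) +ₚ a ·ₚ (0# ∷ (A *ₚ C))     ≈⟨ ·ₚ-distribˡ-+ₚ a (x ·ₚ C) (0# ∷ (A *ₚ C)) ⟨
      a ·ₚ ((x ∷ A) *ₚ C)                       ∎

    *ₚ-·ₚ-comm : ∀ a A C → (A *ₚ (a ·ₚ C)) ≈ₚ (a ·ₚ (A *ₚ C))
    *ₚ-·ₚ-comm a []      C = []≈[]
    *ₚ-·ₚ-comm a (x ∷ A) C = begin
      x ·ₚ (a ·ₚ C) +ₚ (0# ∷ (A *ₚ (a ·ₚ C)))   ≈⟨ +ₚ-cong (·ₚ-assoc x a C) (∷≈∷ refl (*ₚ-·ₚ-comm a A C)) ⟩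
      (x * a) ·ₚ C +ₚ (0# ∷ (a ·ₚ (A *ₚ C)))    ≈⟨ +ₚ-cong (·ₚ-cong (*-comm a x) ≈ₚ-refl) (·ₚ-shift a (A *ₚ C)) ⟨
      (a * x) ·ₚ C +ₚ a ·ₚ (0# ∷ (A *ₚ C))      ≈⟨ +ₚ-cong (·ₚ-assoc a x C) ≈ₚ-refl ⟨
      a ·ₚ (x ·ₚ C) +ₚ a ·ₚ (0# ∷ (A *ₚ C))     ≈⟨ ·ₚ-distribˡ-+ₚ a (x ·ₚ C) (0# ∷ (A *ₚ C)) ⟨
      a ·ₚ ((x ∷ A) *ₚ C)                       ∎

    *ₚ-distribˡ-+ₚ : ∀ A B C → (A *ₚ (B +ₚ C)) ≈ₚ (A *ₚ B +ₚ A *ₚ C)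
    *ₚ-distribˡ-+ₚ []      B C = []≈[]
    *ₚ-distribˡ-+ₚ (x ∷ A) B C = begin
      x ·ₚ (B +ₚ C) +ₚ (0# ∷ (A *ₚ (B +ₚ C)))
        ≈⟨ +ₚ-cong (·ₚ-distribˡ-+ₚ x B C) (∷≈∷ (sym (+-identityˡ 0#)) (*ₚ-distribˡ-+ₚ A B C)) ⟩
      (x ·ₚ B +ₚ x ·ₚ C) +ₚ ((0# ∷ (A *ₚ B)) +ₚ (0# ∷ (A *ₚ C)))
        ≈⟨ +ₚ-interchange (x ·ₚ B) (x ·ₚ C) _ _ ⟩
      (x ∷ A) *ₚ B +ₚ (x ∷ A) *ₚ C
        ∎

    *ₚ-distribʳ-+ₚ : ∀ A B C → ((A +ₚ B) *ₚ C) ≈ₚ (A *ₚ C +ₚ B *ₚ C)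
    *ₚ-distribʳ-+ₚ []      B       C = ≈ₚ-refl
    *ₚ-distribʳ-+ₚ (x ∷ A) []      C = ≈ₚ-sym (+ₚ-identityʳ _)
    *ₚ-distribʳ-+ₚ (x ∷ A) (y ∷ B) C = begin
      (x + y) ·ₚ C +ₚ (0# ∷ ((A +ₚ B) *ₚ C))
        ≈⟨ +ₚ-cong (·ₚ-distribʳ-+ x y C) (∷≈∷ (sym (+-identityˡ 0#)) (*ₚ-distribʳ-+ₚ A B C)) ⟩
      (x ·ₚ C +ₚ y ·ₚ C) +ₚ ((0# ∷ (A *ₚ C)) +ₚ (0# ∷ (B *ₚ C)))
        ≈⟨ +ₚ-interchange (x ·ₚ C) (y ·ₚ C) _ _ ⟩
      (x ∷ A) *ₚ C +ₚ (y ∷ B) *ₚ C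
        ∎

    *ₚ-comm : ∀ A B → (A *ₚ B) ≈ₚ (B *ₚ A)
    *ₚ-comm []      B = ≈ₚ-sym (*ₚ-zeroʳ B)
    *ₚ-comm (x ∷ A) B = begin
      x ·ₚ B +ₚ (0# ∷ (A *ₚ B))               ≈⟨ +ₚ-cong (·ₚ-cong refl (*ₚ-identityʳ B)) (∷≈∷ refl (*ₚ-comm B A)) ⟨
      x ·ₚ (B *ₚ [ 1# ]) +ₚ (0# ∷ (B *ₚ A))   ≈⟨ +ₚ-cong (*ₚ-·ₚ-comm x B [ 1# ]) (*ₚ-shiftʳ B A) ⟨
      B *ₚ (x ·ₚ [ 1# ]) +ₚ B *ₚ (0# ∷ A)     ≈⟨ *ₚ-distribˡ-+ₚ B (x ·ₚ [ 1# ]) (0# ∷ A) ⟨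
      B *ₚ (x ·ₚ [ 1# ] +ₚ (0# ∷ A))          ≈⟨ *ₚ-congʳ B (∷≈∷ (trans (+-identityʳ _) (*-identityʳ x)) ≈ₚ-refl) ⟩
      B *ₚ (x ∷ A)                            ∎

    *ₚ-assoc : ∀ A B C → ((A *ₚ B) *ₚ C) ≈ₚ (A *ₚ (B *ₚ C))
    *ₚ-assoc []      B C = []≈[]
    *ₚ-assoc (x ∷ A) B C = begin
      (x ·ₚ B +ₚ (0# ∷ (A *ₚ B))) *ₚ C          ≈⟨ *ₚ-distribʳ-+ₚ (x ·ₚ B) (0# ∷ (A *ₚ B)) C ⟩
      (x ·ₚ B) *ₚ C +ₚ (0# ∷ (A *ₚ B)) *ₚ C     ≈⟨ +ₚ-cong (*ₚ-·ₚ-assoc x B C) (*ₚ-shiftˡ (A *ₚ B) C) ⟩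
      x ·ₚ (B *ₚ C) +ₚ (0# ∷ ((A *ₚ B) *ₚ C))   ≈⟨ +ₚ-cong ≈ₚ-refl (∷≈∷ refl (*ₚ-assoc A B C)) ⟩
      (x ∷ A) *ₚ (B *ₚ C)                       ∎

    powₚ-one : ∀ n → powₚ [ 1# ] n ≈ₚ [ 1# ]
    powₚ-one zero    = ≈ₚ-refl
    powₚ-one (suc n) = ≈ₚ-trans (*ₚ-identityˡ _) (powₚ-one n)

module LeadingTerms (R : CommutativeRing 0ℓ 0ℓ) where
  open CommutativeRing R hiding (zero)
  open Over R
  open Polynomials R

  length-·ₚ : ∀ a A → length (a ·ₚ A) ≡ length A
  length-·ₚ a []      = ≡.refl
  length-·ₚ a (x ∷ A) = ≡.cong suc (length-·ₚ a A)

  ·ₚ-++ : ∀ a A B → a ·ₚ (A ++ B) ≡ a ·ₚ A ++ a ·ₚ B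
  ·ₚ-++ a []      B = ≡.refl
  ·ₚ-++ a (x ∷ A) B = ≡.cong (a * x ∷_) (·ₚ-++ a A B)

  length-+ₚ : ∀ A B → length A ≤ length B → length (A +ₚ B) ≡ length B
  length-+ₚ []      B       _       = ≡.refl
  length-+ₚ (x ∷ A) (y ∷ B) (s≤s h) = ≡.cong suc (length-+ₚ A B h)

  +ₚ-++-last : ∀ A B e → length A ≤ length B → A +ₚ (B ++ [ e ]) ≡ (A +ₚ B) ++ [ e ]
  +ₚ-++-last []      B       e _       = ≡.refl
  +ₚ-++-last (x ∷ A) (y ∷ B) e (s≤s h) = ≡.cong (x + y ∷_) (+ₚ-++-last A B e h)

  coeff-++-last : ∀ l c → coeff (l ++ [ c ]) (length l) ≡ c
  coeff-++-last []      c = ≡.refl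
  coeff-++-last (x ∷ l) c = coeff-++-last l c

  []≈ₚ-++-last⇒≈0 : ∀ l c → [] ≈ₚ (l ++ [ c ]) → c ≈ 0#
  []≈ₚ-++-last⇒≈0 l c e = sym (≡.subst (0# ≈_) (coeff-++-last l c) (≈ₚ⇒≈ᶜ e (length l)))

  ++-last-injective : ∀ l l′ {c c′} → ¬ (c ≈ 0#) → ¬ (c′ ≈ 0#) → (l ++ [ c ]) ≈ₚ (l′ ++ [ c′ ]) →
                      length l ≡ length l′ × c ≈ c′
  ++-last-injective []      []       _   _    (∷≈∷ c≈c′ _) = ≡.refl , c≈c′
  ++-last-injective []      (_ ∷ l′) _   c′≉0 (∷≈∷ _ e)    = ⊥-elim (c′≉0 ([]≈ₚ-++-last⇒≈0 l′ _ e))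
  ++-last-injective (_ ∷ l) []       c≉0 _    (∷≈∷ _ e)    = ⊥-elim (c≉0 ([]≈ₚ-++-last⇒≈0 l _ (≈ₚ-sym e)))
  ++-last-injective (_ ∷ l) (_ ∷ l′) c≉0 c′≉0 (∷≈∷ _ e)    with ++-last-injective l l′ c≉0 c′≉0 e
  ... | |l|≡|l′| , c≈c′ = ≡.cong suc |l|≡|l′| , c≈c′

  *ₚ-++-last : ∀ c d l w →
               ∃[ u ] (length u ≡ length l ℕ.+ length w × ((l ++ [ c ]) *ₚ (w ++ [ d ])) ≈ₚ (u ++ [ c * d ]))
  *ₚ-++-last c d []      w = c ·ₚ w , length-·ₚ c w , (begin
    c ·ₚ (w ++ [ d ]) +ₚ [ 0# ]   ≈⟨ +ₚ-cong ≈ₚ-refl (∷≈[] refl []≈[]) ⟩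
    c ·ₚ (w ++ [ d ]) +ₚ []       ≈⟨ +ₚ-identityʳ _ ⟩
    c ·ₚ (w ++ [ d ])             ≡⟨ ·ₚ-++ c w [ d ] ⟩
    c ·ₚ w ++ [ c * d ]           ∎)
    where open ≈ₚ-Reasoning
  *ₚ-++-last c d (a ∷ l) w with *ₚ-++-last c d l w
  ... | u , |u| , e = a ·ₚ W +ₚ (0# ∷ u) , ≡.trans (length-+ₚ (a ·ₚ W) (0# ∷ u) short) (≡.cong suc |u|) , (begin
    a ·ₚ W +ₚ (0# ∷ ((l ++ [ c ]) *ₚ W))   ≈⟨ +ₚ-cong ≈ₚ-refl (∷≈∷ refl e) ⟩
    a ·ₚ W +ₚ (0# ∷ u ++ [ c * d ])        ≡⟨ +ₚ-++-last (a ·ₚ W) (0# ∷ u) (c * d) short ⟩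
    (a ·ₚ W +ₚ (0# ∷ u)) ++ [ c * d ]      ∎)
    where
    open ≈ₚ-Reasoning
    W = w ++ [ d ]
    short : length (a ·ₚ W) ≤ length (0# ∷ u)
    short = ≡.subst₂ _≤_ (≡.sym (≡.trans (length-·ₚ a W) (≡.trans (length-++ w) (ℕ.+-comm (length w) 1))))
              (≡.cong suc (≡.sym |u|)) (s≤s (ℕ.m≤n+m (length w) (length l)))

  hasLead : ∀ {P c} l → ¬ (c ≈ 0#) → P ≈ₚ (l ++ [ c ]) → HasLead P (length l) c
  hasLead {P} {c} l c≉0 e = c≉0 , fromList l , ≡.subst (λ t → P ≈ₚ (t ++ [ c ])) (≡.sym (toList∘fromList l)) e

  monomial : ℕ → Carrier → Poly
  monomial m c = toList (Vec.replicate m 0#) ++ [ c ]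

  monomial-hasLead : ∀ m {c} → ¬ (c ≈ 0#) → HasLead (monomial m c) m c
  monomial-hasLead m c≉0 = c≉0 , Vec.replicate m 0# , ≈ₚ-refl

  HasLead⇒NonZeroPoly : ∀ {P m c} → HasLead P m c → NonZeroPoly P
  HasLead⇒NonZeroPoly (c≉0 , v , e) P≈[] = c≉0 ([]≈ₚ-++-last⇒≈0 (toList v) _ (≈ₚ-trans (≈ₚ-sym P≈[]) e))

  HasLead-unique : ∀ {P P′ m m′ c c′} → P ≈ₚ P′ → HasLead P m c → HasLead P′ m′ c′ → m ≡ m′ × c ≈ c′
  HasLead-unique e (c≉0 , v , eP) (c′≉0 , v′ , eP′)
    with ++-last-injective (toList v) (toList v′) c≉0 c′≉0 (≈ₚ-trans (≈ₚ-sym eP) (≈ₚ-trans e eP′))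
  ... | |l|≡|l′| , c≈c′ = ≡.trans (≡.sym (length-toList v)) (≡.trans |l|≡|l′| (length-toList v′)) , c≈c′

  HasLead-resp-≈ : ∀ {P m c c′} → c ≈ c′ → HasLead P m c → HasLead P m c′
  HasLead-resp-≈ c≈c′ (c≉0 , v , e) = (λ c′≈0 → c≉0 (trans c≈c′ c′≈0)) , v , ≈ₚ-trans e (++-last-cong (toList v))
    where
    ++-last-cong : ∀ l → (l ++ [ _ ]) ≈ₚ (l ++ [ _ ])
    ++-last-cong []      = ∷≈∷ c≈c′ []≈[]
    ++-last-cong (x ∷ l) = ∷≈∷ refl (++-last-cong l)

  module NoZeroDivisors (*-nonzero : ∀ {x y} → ¬ (x ≈ 0#) → ¬ (y ≈ 0#) → ¬ (x * y ≈ 0#)) (1≉0 : ¬ (1# ≈ 0#)) where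

    HasLead-*ₚ : ∀ {P Q m k c d} → HasLead P m c → HasLead Q k d → HasLead (P *ₚ Q) (m ℕ.+ k) (c * d)
    HasLead-*ₚ {P} {Q} {c = c} {d} (c≉0 , v , eP) (d≉0 , w , eQ) with *ₚ-++-last c d (toList v) (toList w)
    ... | u , |u| , e = ≡.subst (λ k → HasLead (P *ₚ Q) k (c * d))
          (≡.trans |u| (≡.cong₂ ℕ._+_ (length-toList v) (length-toList w)))
          (hasLead u (*-nonzero c≉0 d≉0) (≈ₚ-trans (≈ₚ-trans (*ₚ-congˡ Q eP) (*ₚ-congʳ (toList v ++ [ c ]) eQ)) e))

    HasLead-powₚ : ∀ {P m c} → HasLead P m c → ∀ k → HasLead (powₚ P k) (k ℕ.* m) (pow c k)
    HasLead-powₚ h zero    = 1≉0 , Vec.[] , ≈ₚ-refl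
    HasLead-powₚ h (suc k) = HasLead-*ₚ h (HasLead-powₚ h k)

  module DecidableEquality (_≟_ : Decidable _≈_) where

    ≈ₚ[]? : ∀ P → Dec (P ≈ₚ [])
    ≈ₚ[]? []      = yes []≈[]
    ≈ₚ[]? (x ∷ P) with x ≟ 0# | ≈ₚ[]? P
    ... | yes x≈0 | yes P≈[] = yes (∷≈[] x≈0 P≈[])
    ... | no x≉0  | _        = no λ { (∷≈[] x≈0 _) → x≉0 x≈0 }
    ... | yes _   | no P≉[]  = no λ { (∷≈[] _ P≈[]) → P≉[] P≈[] }

    leadingTerm : ∀ P → NonZeroPoly P → ∃[ m ] ∃[ c ] HasLead P m c
    leadingTerm []      P≉[] = ⊥-elim (P≉[] []≈[])
    leadingTerm (x ∷ P) xP≉[] with ≈ₚ[]? P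
    ... | yes P≈[] = 0 , x , (λ x≈0 → xP≉[] (∷≈[] x≈0 P≈[])) , Vec.[] , ∷≈∷ refl P≈[]
    ... | no P≉[] with leadingTerm P P≉[]
    ... | m , c , c≉0 , v , e = suc m , c , c≉0 , x Vec.∷ v , ∷≈∷ refl e

≡-mod-by-multiple : ∀ {m} x y k → x ≡ y ℤ.+ k ℤ.* (+ m) → x ≡ y [mod m ]
≡-mod-by-multiple {m} x y k x≡y+km =
  Signed.∣⇒∣ᵤ (Signed.divides k (≡.trans (≡.cong (ℤ._- y) x≡y+km) (cancel y (k ℤ.* (+ m)))))
  where
  cancel : ∀ a b → (a ℤ.+ b) ℤ.- a ≡ b
  cancel = solve-∀

≡-mod-reflexive : ∀ {m} x y → x ≡ y → x ≡ y [mod m ]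
≡-mod-reflexive {m} x y x≡y = ≡-mod-by-multiple x y (+ 0)
  (≡.trans x≡y (≡.trans (≡.sym (ℤ.+-identityʳ y)) (≡.cong (λ t → y ℤ.+ t) (≡.sym (ℤ.*-zeroˡ (+ m))))))

≡-mod-refl : ∀ {m} x → x ≡ x [mod m ]
≡-mod-refl x = ≡-mod-reflexive x x ≡.refl

≡-mod-sym : ∀ {m} x y → x ≡ y [mod m ] → y ≡ x [mod m ]
≡-mod-sym {m} x y = ≡.subst (m ∣_) (ℤ.∣i-j∣≡∣j-i∣ x y)

≡-mod-trans : ∀ {m} x y z → x ≡ y [mod m ] → y ≡ z [mod m ] → x ≡ z [mod m ]
≡-mod-trans {m} x y z x≡y y≡z = Signed.∣⇒∣ᵤ (≡.subst (Signed._∣_ (+ m)) (split x y z)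
  (Signed.∣m∣n⇒∣m+n (Signed.∣ᵤ⇒∣ {i = x ℤ.- y} x≡y) (Signed.∣ᵤ⇒∣ {i = y ℤ.- z} y≡z)))
  where
  split : ∀ a b c → (a ℤ.- b) ℤ.+ (b ℤ.- c) ≡ a ℤ.- c
  split = solve-∀

≡-mod⇒∣∸ : ∀ {m e e′} → e′ ≤ e → (+ e) ≡ (+ e′) [mod m ] → m ∣ e ℕ.∸ e′
≡-mod⇒∣∸ {m} {e} {e′} e′≤e = ≡.subst (m ∣_) (≡.cong ℤ.∣_∣ (≡.trans (ℤ.m-n≡m⊖n e e′) (ℤ.⊖-≥ e′≤e)))

module Powers (R : CommutativeRing 0ℓ 0ℓ) where
  open CommutativeRing R hiding (zero)
  open Over R
  open SemiringExp semiring using (_^_; ^-congˡ; ^-homo-*; ^-assocʳ)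
  open SetoidReasoning setoid

  pow≡^ : ∀ x n → pow x n ≡ x ^ n
  pow≡^ x zero    = ≡.refl
  pow≡^ x (suc n) = ≡.cong (x *_) (pow≡^ x n)

  pow-cong : ∀ {x y} n → x ≈ y → pow x n ≈ pow y n
  pow-cong {x} {y} n x≈y rewrite pow≡^ x n | pow≡^ y n = ^-congˡ n x≈y

  pow-+ : ∀ x m n → pow x (m ℕ.+ n) ≈ pow x m * pow x n
  pow-+ x m n rewrite pow≡^ x (m ℕ.+ n) | pow≡^ x m | pow≡^ x n = ^-homo-* x m n

  pow-* : ∀ x m n → pow (pow x m) n ≈ pow x (m ℕ.* n)
  pow-* x m n rewrite pow≡^ (pow x m) n | pow≡^ x m | pow≡^ x (m ℕ.* n) = ^-assocʳ x m n

  pow-one : ∀ n → pow 1# n ≈ 1#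
  pow-one zero    = refl
  pow-one (suc n) = trans (*-identityˡ _) (pow-one n)

  pow-+-multiple : ∀ {x d} → pow x d ≈ 1# → ∀ e k → pow x (e ℕ.+ k ℕ.* d) ≈ pow x e
  pow-+-multiple {x} {d} xᵈ≈1 e k = begin
    pow x (e ℕ.+ k ℕ.* d)       ≈⟨ pow-+ x e (k ℕ.* d) ⟩
    pow x e * pow x (k ℕ.* d)   ≡⟨ ≡.cong (λ t → pow x e * pow x t) (ℕ.*-comm k d) ⟩
    pow x e * pow x (d ℕ.* k)   ≈⟨ *-congˡ (pow-* x d k) ⟨
    pow x e * pow (pow x d) k   ≈⟨ *-congˡ (trans (pow-cong k xᵈ≈1) (pow-one k)) ⟩
    pow x e * 1#                ≈⟨ *-identityʳ _ ⟩
    pow x e                     ∎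

  pow-cong-∣∸ : ∀ {x d e e′} → pow x d ≈ 1# → e′ ≤ e → d ∣ e ℕ.∸ e′ → pow x e ≈ pow x e′
  pow-cong-∣∸ {x} {d} {e} {e′} xᵈ≈1 e′≤e (divides k e∸e′≡kd) = begin
    pow x e                    ≡⟨ ≡.cong (pow x) (ℕ.m+[n∸m]≡n e′≤e) ⟨
    pow x (e′ ℕ.+ (e ℕ.∸ e′))  ≡⟨ ≡.cong (λ t → pow x (e′ ℕ.+ t)) e∸e′≡kd ⟩
    pow x (e′ ℕ.+ k ℕ.* d)     ≈⟨ pow-+-multiple xᵈ≈1 e′ k ⟩
    pow x e′                   ∎

  pow-% : ∀ {x d} → pow x (suc d) ≈ 1# → ∀ e → pow x e ≈ pow x (e % suc d)
  pow-% {x} {d} xᵈ≈1 e = begin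
    pow x e                                       ≡⟨ ≡.cong (pow x) (m≡m%n+[m/n]*n e (suc d)) ⟩
    pow x (e % suc d ℕ.+ (e / suc d) ℕ.* suc d)   ≈⟨ pow-+-multiple xᵈ≈1 (e % suc d) (e / suc d) ⟩
    pow x (e % suc d)                             ∎

  pow-suc≉0⇒≉0 : ∀ {x} e → ¬ (pow x (suc e) ≈ 0#) → ¬ (x ≈ 0#)
  pow-suc≉0⇒≉0 e xᵉ⁺¹≉0 x≈0 = xᵉ⁺¹≉0 (trans (*-congʳ x≈0) (zeroˡ _))

module Fields (F : CommutativeRing 0ℓ 0ℓ) (isField : Over.IsField F) where
  open CommutativeRing F hiding (zero)
  open Over F
  open SetoidReasoning setoid
  open GroupProperties +-group using (inverseˡ-unique; ⁻¹-involutive)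
  open import Algebra.Properties.Ring ring using (-1*x≈-x)

  1≉0 : ¬ (1# ≈ 0#)
  1≉0 = proj₁ isField

  *-cancelʳ : ∀ {x a b} → ¬ (x ≈ 0#) → a * x ≈ b * x → a ≈ b
  *-cancelʳ {x} {a} {b} x≉0 ax≈bx with proj₂ isField x x≉0
  ... | y , xy≈1 = begin
    a              ≈⟨ *-identityʳ a ⟨
    a * 1#         ≈⟨ *-congˡ xy≈1 ⟨
    a * (x * y)    ≈⟨ *-assoc a x y ⟨
    (a * x) * y    ≈⟨ *-congʳ ax≈bx ⟩
    (b * x) * y    ≈⟨ *-assoc b x y ⟩
    b * (x * y)    ≈⟨ *-congˡ xy≈1 ⟩
    b * 1#         ≈⟨ *-identityʳ b ⟩
    b              ∎

  *-cancelˡ : ∀ {x a b} → ¬ (x ≈ 0#) → x * a ≈ x * b → a ≈ b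
  *-cancelˡ {x} {a} {b} x≉0 xa≈xb = *-cancelʳ x≉0 (trans (*-comm a x) (trans xa≈xb (*-comm x b)))

  *-nonzero : ∀ {x y} → ¬ (x ≈ 0#) → ¬ (y ≈ 0#) → ¬ (x * y ≈ 0#)
  *-nonzero {x} x≉0 y≉0 xy≈0 = y≉0 (*-cancelˡ x≉0 (trans xy≈0 (sym (zeroʳ x))))

  pow-nonzero : ∀ {x} n → ¬ (x ≈ 0#) → ¬ (pow x n ≈ 0#)
  pow-nonzero zero    x≉0 = 1≉0
  pow-nonzero (suc n) x≉0 = *-nonzero x≉0 (pow-nonzero n x≉0)

  -1*-1≈1 : - 1# * - 1# ≈ 1#
  -1*-1≈1 = trans (-1*x≈-x (- 1#)) (⁻¹-involutive 1#)

  -1≉0 : ¬ (- 1# ≈ 0#)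
  -1≉0 -1≈0 = 1≉0 (trans (sym -1*-1≈1) (trans (*-congʳ -1≈0) (zeroˡ _)))

  module _ (_≟_ : Decidable _≈_) where

    -- y² = 1 gives y (y + 1) = y + 1, so either y + 1 = 0 or y + 1 cancels.
    square≈1⇒≈±1 : ∀ {y} → y * y ≈ 1# → y ≈ 1# ⊎ y ≈ - 1#
    square≈1⇒≈±1 {y} y²≈1 with (y + 1#) ≟ 0#
    ... | yes y+1≈0 = inj₂ (inverseˡ-unique y 1# y+1≈0)
    ... | no  y+1≉0 = inj₁ (*-cancelʳ y+1≉0 (begin
      y * (y + 1#)      ≈⟨ distribˡ y y 1# ⟩
      y * y + y * 1#    ≈⟨ +-cong y²≈1 (*-identityʳ y) ⟩
      1# + y            ≈⟨ +-comm 1# y ⟩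
      y + 1#            ≈⟨ *-identityˡ _ ⟨
      1# * (y + 1#)     ∎))

module FiniteFields (F : CommutativeRing 0ℓ 0ℓ) (isField : Over.IsField F) (q′ : ℕ)
  (B : Bijection (≡.setoid (Fin (suc q′))) (CommutativeRing.setoid F)) where
  open CommutativeRing F hiding (zero)
  open Over F
  open Powers F
  open Fields F isField
  open SetoidReasoning setoid
  open Inverse (Bijection⇒Inverse B) using (to; from; from-cong; inverseˡ; inverseʳ)

  from-injective : ∀ {x y} → from x ≡ from y → x ≈ y
  from-injective {x} {y} e = trans (sym (inverseˡ ≡.refl)) (inverseˡ e)

  _≟_ : Decidable _≈_
  x ≟ y = map′ from-injective from-cong (from x Fin.≟ from y)

  nonzeroElement : Fin q′ → Carrier
  nonzeroElement i = to (punchIn (from 0#) i)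

  nonzeroElement-≉0 : ∀ i → ¬ (nonzeroElement i ≈ 0#)
  nonzeroElement-≉0 i e = Fin.punchInᵢ≢i (from 0#) i (≡.trans (≡.sym (inverseʳ refl)) (from-cong e))

  nonzeroElement-injective : ∀ {i j} → nonzeroElement i ≈ nonzeroElement j → i ≡ j
  nonzeroElement-injective {i} {j} e = Fin.punchIn-injective (from 0#) i j
    (≡.trans (≡.sym (inverseʳ refl)) (≡.trans (from-cong e) (inverseʳ refl)))

  from-0#≢from : ∀ {x} → ¬ (x ≈ 0#) → ¬ (from 0# ≡ from x)
  from-0#≢from x≉0 e = x≉0 (sym (from-injective e))

  nonzeroIndex : ∀ x → ¬ (x ≈ 0#) → Fin q′
  nonzeroIndex x x≉0 = punchOut (from-0#≢from x≉0)

  nonzeroIndex-injective : ∀ {x y} (x≉0 : ¬ (x ≈ 0#)) (y≉0 : ¬ (y ≈ 0#)) →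
                           nonzeroIndex x x≉0 ≡ nonzeroIndex y y≉0 → x ≈ y
  nonzeroIndex-injective x≉0 y≉0 e = from-injective (Fin.punchOut-injective (from-0#≢from x≉0) (from-0#≢from y≉0) e)

  1≤q′ : 1 ≤ q′
  1≤q′ = ℕ.≤-trans (s≤s z≤n) (Fin.toℕ<n (nonzeroIndex 1# 1≉0))

  powers-below⇒q′≤ : ∀ {y d} → (∀ x → ¬ (x ≈ 0#) → ∃[ e ] (e < d × x ≈ pow y e)) → q′ ≤ d
  powers-below⇒q′≤ {y} {d} below = Fin.injective⇒≤ {f = exponent} exponent-injective
    where
    exponent : Fin q′ → Fin d
    exponent i with below (nonzeroElement i) (nonzeroElement-≉0 i)
    ... | e , e<d , _ = fromℕ< e<d
    exponent-injective : ∀ {i j} → exponent i ≡ exponent j → i ≡ j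
    exponent-injective {i} {j} eq with below (nonzeroElement i) (nonzeroElement-≉0 i)
                                     | below (nonzeroElement j) (nonzeroElement-≉0 j)
    ... | a , a<d , xᵢ≈yᵃ | b , b<d , xⱼ≈yᵇ = nonzeroElement-injective (begin
      nonzeroElement i   ≈⟨ xᵢ≈yᵃ ⟩
      pow y a            ≡⟨ ≡.cong (pow y) (Fin.fromℕ<-injective a b a<d b<d eq) ⟩
      pow y b            ≈⟨ xⱼ≈yᵇ ⟨
      nonzeroElement j   ∎)

  -- pigeonhole on x⁰, …, x^q′, which all lie among the q′ nonzero elements
  ∃-order : ∀ {x} → ¬ (x ≈ 0#) → ∃[ d ] (1 ≤ d × d ≤ q′ × pow x d ≈ 1#)
  ∃-order {x} x≉0 with Fin.pigeonhole (ℕ.n<1+n q′) (λ i → nonzeroIndex (pow x (toℕ i)) (pow-nonzero (toℕ i) x≉0))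
  ... | i , j , i<j , same = toℕ j ℕ.∸ toℕ i , ℕ.m<n⇒0<n∸m i<j ,
        ℕ.≤-trans (ℕ.m∸n≤m (toℕ j) (toℕ i)) (Fin.toℕ≤pred[n] j) ,
        *-cancelˡ (pow-nonzero a x≉0) (begin
          pow x a * pow x (b ℕ.∸ a)   ≈⟨ pow-+ x a (b ℕ.∸ a) ⟨
          pow x (a ℕ.+ (b ℕ.∸ a))     ≡⟨ ≡.cong (pow x) (ℕ.m+[n∸m]≡n (ℕ.<⇒≤ i<j)) ⟩
          pow x b                     ≈⟨ nonzeroIndex-injective (pow-nonzero a x≉0) (pow-nonzero b x≉0) same ⟨
          pow x a                     ≈⟨ *-identityʳ _ ⟨
          pow x a * 1#                ∎)
    where
    a = toℕ i
    b = toℕ j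

  -- g ≈ 0# is allowed when q′ = 1: the only nonzero element is then 1# = g⁰.
  module Generator (g : Carrier) (generates : ∀ x → ¬ (x ≈ 0#) → ∃[ e ] x ≈ pow g e) where

    g≈0⇒q′≤1 : g ≈ 0# → q′ ≤ 1
    g≈0⇒q′≤1 g≈0 = powers-below⇒q′≤ below-1
      where
      below-1 : ∀ x → ¬ (x ≈ 0#) → ∃[ e ] (e < 1 × x ≈ pow g e)
      below-1 x x≉0 with generates x x≉0
      ... | zero  , x≈1 = 0 , s≤s z≤n , x≈1
      ... | suc e , x≈gᵉ⁺¹ = ⊥-elim (pow-suc≉0⇒≉0 e (λ gᵉ⁺¹≈0 → x≉0 (trans x≈gᵉ⁺¹ gᵉ⁺¹≈0)) g≈0)

    q′≤order : ∀ {d} → pow g (suc d) ≈ 1# → q′ ≤ suc d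
    q′≤order {d} gᵈ≈1 = powers-below⇒q′≤ below
      where
      below : ∀ x → ¬ (x ≈ 0#) → ∃[ e ] (e < suc d × x ≈ pow g e)
      below x x≉0 with generates x x≉0
      ... | e , x≈gᵉ = e % suc d , m%n<n e (suc d) , trans x≈gᵉ (pow-% gᵈ≈1 e)

    pow-g-q′≈1 : ¬ (g ≈ 0#) → pow g q′ ≈ 1#
    pow-g-q′≈1 g≉0 with ∃-order g≉0
    ... | suc d , _ , d≤q′ , gᵈ≈1 = ≡.subst (λ t → pow g t ≈ 1#) (ℕ.≤-antisym d≤q′ (q′≤order gᵈ≈1)) gᵈ≈1

    fermat : ∀ {x} → ¬ (x ≈ 0#) → pow x q′ ≈ 1#
    fermat {x} x≉0 with generates x x≉0
    ... | zero  , x≈1 = trans (pow-cong q′ x≈1) (pow-one q′)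
    ... | suc e , x≈gᵉ⁺¹ = begin
      pow x q′                       ≈⟨ pow-cong q′ x≈gᵉ⁺¹ ⟩
      pow (pow g (suc e)) q′         ≈⟨ pow-* g (suc e) q′ ⟩
      pow g (suc e ℕ.* q′)           ≡⟨ ≡.cong (pow g) (ℕ.*-comm (suc e) q′) ⟩
      pow g (q′ ℕ.* suc e)           ≈⟨ pow-* g q′ (suc e) ⟨
      pow (pow g q′) (suc e)         ≈⟨ pow-cong (suc e) (pow-g-q′≈1 g≉0) ⟩
      pow 1# (suc e)                 ≈⟨ pow-one (suc e) ⟩
      1#                             ∎
      where
      g≉0 : ¬ (g ≈ 0#)
      g≉0 = pow-suc≉0⇒≉0 e (λ gᵉ⁺¹≈0 → x≉0 (trans x≈gᵉ⁺¹ gᵉ⁺¹≈0))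

    pow-cong-mod : ∀ {x} e e′ → ¬ (x ≈ 0#) → (+ e) ≡ (+ e′) [mod q′ ] → pow x e ≈ pow x e′
    pow-cong-mod e e′ x≉0 e≡e′ with ℕ.≤-total e′ e
    ... | inj₁ e′≤e = pow-cong-∣∸ (fermat x≉0) e′≤e (≡-mod⇒∣∸ e′≤e e≡e′)
    ... | inj₂ e≤e′ = sym (pow-cong-∣∸ (fermat x≉0) e≤e′ (≡-mod⇒∣∸ e≤e′ (≡-mod-sym (+ e) (+ e′) e≡e′)))

    pow≉0-cong-mod : ∀ {x} e e′ → ¬ (pow x e ≈ 0#) → ¬ (pow x e′ ≈ 0#) → (+ e) ≡ (+ e′) [mod q′ ] →
                     pow x e ≈ pow x e′
    pow≉0-cong-mod zero    zero     _    _     _    = refl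
    pow≉0-cong-mod (suc e) e′       xᵉ≉0 _     e≡e′ = pow-cong-mod (suc e) e′ (pow-suc≉0⇒≉0 e xᵉ≉0) e≡e′
    pow≉0-cong-mod zero    (suc e′) _    xᵉ′≉0 e≡e′ = pow-cong-mod zero (suc e′) (pow-suc≉0⇒≉0 e′ xᵉ′≉0) e≡e′

    pow-g≉0 : ∀ {e} → e < q′ → ¬ (pow g e ≈ 0#)
    pow-g≉0 {zero}  _   = 1≉0
    pow-g≉0 {suc e} e<q′ gᵉ⁺¹≈0 with g ≟ 0#
    ... | yes g≈0 = ℕ.<⇒≱ e<q′ (ℕ.≤-trans (g≈0⇒q′≤1 g≈0) (s≤s z≤n))
    ... | no  g≉0 = pow-nonzero (suc e) g≉0 gᵉ⁺¹≈0

    -- g^h squares to 1 but is not 1, since g has order q′ = 2h > h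
    pow-g-half≈-1 : ∀ h → q′ ≡ h ℕ.* 2 → pow g h ≈ - 1#
    pow-g-half≈-1 zero    q′≡0   = ⊥-elim (ℕ.<⇒≢ 1≤q′ (≡.sym q′≡0))
    pow-g-half≈-1 (suc h) q′≡2h with square≈1⇒≈±1 _≟_ gʰgʰ≈1
      where
      g≉0 : ¬ (g ≈ 0#)
      g≉0 g≈0 = ℕ.<⇒≱ (≡.subst (1 ℕ.<_) (≡.sym q′≡2h) (s≤s (s≤s z≤n))) (g≈0⇒q′≤1 g≈0)
      gʰgʰ≈1 : pow g (suc h) * pow g (suc h) ≈ 1#
      gʰgʰ≈1 = begin
        pow g (suc h) * pow g (suc h)    ≈⟨ *-congˡ (*-identityʳ _) ⟨
        pow (pow g (suc h)) 2            ≈⟨ pow-* g (suc h) 2 ⟩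
        pow g (suc h ℕ.* 2)              ≡⟨ ≡.cong (pow g) q′≡2h ⟨
        pow g q′                         ≈⟨ pow-g-q′≈1 g≉0 ⟩
        1#                               ∎
    ... | inj₂ gʰ≈-1 = gʰ≈-1
    ... | inj₁ gʰ≈1  = ⊥-elim (ℕ.<⇒≱ h<q′ (q′≤order gʰ≈1))
      where
      h<q′ : suc h < q′
      h<q′ = ≡.subst (suc h <_) (≡.sym q′≡2h) (s≤s (s≤s (ℕ.m≤m*n h 2)))

    q′-odd⇒-1≈1 : ∀ t → q′ ≡ suc (t ℕ.* 2) → - 1# ≈ 1#
    q′-odd⇒-1≈1 t q′≡2t+1 = begin
      - 1#                             ≈⟨ *-identityʳ _ ⟨
      - 1# * 1#                        ≈⟨ *-congˡ (trans (pow-cong t [-1]²≈1) (pow-one t)) ⟨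
      - 1# * pow (pow (- 1#) 2) t      ≈⟨ *-congˡ (pow-* (- 1#) 2 t) ⟩
      pow (- 1#) (suc (2 ℕ.* t))       ≡⟨ ≡.cong (λ k → pow (- 1#) (suc k)) (ℕ.*-comm 2 t) ⟩
      pow (- 1#) (suc (t ℕ.* 2))       ≡⟨ ≡.cong (pow (- 1#)) q′≡2t+1 ⟨
      pow (- 1#) q′                    ≈⟨ fermat -1≉0 ⟩
      1#                               ∎
      where
      [-1]²≈1 : pow (- 1#) 2 ≈ 1#
      [-1]²≈1 = trans (*-congˡ (*-identityʳ _)) -1*-1≈1

cancel-degrees : ∀ a b c e f q → a ℕ.+ q ℕ.* f ≡ (c ℕ.+ b) ℕ.+ q ℕ.* e → (+ a ℤ.- + b) ≡ (+ c) [mod q ]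
cancel-degrees a b c e f q eq = ≡-mod-by-multiple (+ a ℤ.- + b) (+ c) (+ e ℤ.- + f) (begin
  + a ℤ.- + b                                                ≡⟨ shift (+ a) (+ b) (+ q ℤ.* + f) ⟩
  (+ a ℤ.+ + q ℤ.* + f) ℤ.- (+ b ℤ.+ + q ℤ.* + f)            ≡⟨ ≡.cong (λ t → t ℤ.- (+ b ℤ.+ + q ℤ.* + f)) eqℤ ⟩
  ((+ c ℤ.+ + b) ℤ.+ + q ℤ.* + e) ℤ.- (+ b ℤ.+ + q ℤ.* + f)  ≡⟨ regroup (+ b) (+ c) (+ e) (+ f) (+ q) ⟩
  + c ℤ.+ (+ e ℤ.- + f) ℤ.* + q                              ∎)
  where
  open ≡.≡-Reasoning
  eqℤ : + a ℤ.+ + q ℤ.* + f ≡ (+ c ℤ.+ + b) ℤ.+ + q ℤ.* + e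
  eqℤ rewrite ≡.sym (ℤ.pos-* q f) | ≡.sym (ℤ.pos-* q e) = ≡.cong +_ eq
  shift : ∀ x y z → x ℤ.- y ≡ (x ℤ.+ z) ℤ.- (y ℤ.+ z)
  shift = solve-∀
  regroup : ∀ y x u v w → ((x ℤ.+ y) ℤ.+ w ℤ.* u) ℤ.- (y ℤ.+ w ℤ.* v) ≡ x ℤ.+ (u ℤ.- v) ℤ.* w
  regroup = solve-∀

a+[m∸1]b≡a-b : ∀ a b {k m} → suc k ≡ m → (+ (a ℕ.+ k ℕ.* b)) ≡ (+ a ℤ.- + b) [mod m ]
a+[m∸1]b≡a-b a b {k} ≡.refl = ≡-mod-by-multiple (+ (a ℕ.+ k ℕ.* b)) (+ a ℤ.- + b) (+ b)
  (≡.trans (≡.cong (λ t → + a ℤ.+ t) (ℤ.pos-* k b)) (regroup (+ a) (+ b) (+ k)))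
  where
  regroup : ∀ x y z → x ℤ.+ z ℤ.* y ≡ (x ℤ.- y) ℤ.+ y ℤ.* (ℤ.+ 1 ℤ.+ z)
  regroup = solve-∀

difference-of-naturals : ∀ b → ∃[ m₁ ] ∃[ m₂ ] (+ m₁ ℤ.- + m₂ ≡ b)
difference-of-naturals (+ k)    = k , 0 , ℤ.+-identityʳ (+ k)
difference-of-naturals -[1+ k ] = 0 , suc k , ≡.refl

module Proposition (F : CommutativeRing 0ℓ 0ℓ) (isField : Over.IsField F) (q′ : ℕ)
  (B : Bijection (≡.setoid (Fin (suc q′))) (CommutativeRing.setoid F))
  (g : CommutativeRing.Carrier F)
  (generates : ∀ x → ¬ (CommutativeRing._≈_ F x (CommutativeRing.0# F)) → ∃[ e ] CommutativeRing._≈_ F x (Over.pow F g e))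
  where
  open CommutativeRing F hiding (zero)
  open Over F
  open Polynomials F
  open LeadingTerms F
  open Powers F
  open Fields F isField
  open FiniteFields F isField q′ B
  open Generator g generates
  open NoZeroDivisors *-nonzero 1≉0
  open DecidableEquality _≟_

  q : ℕ
  q = suc q′

  -- Compare leading terms in num f · (den u)^q′ = P · den f · (num u)^q′; by Fermat the u-factors
  -- have leading coefficient 1.
  InSpecialSet⇒PhiIs : ∀ n e₀ → pow g e₀ ≈ pow (- 1#) n → ∀ f → InSpecialSet q n f → PhiIs q g f (+ e₀) (ℤ.- (+ n))
  InSpecialSet⇒PhiIs n e₀ gᵉ⁰≈±1 f (P , m , hP , m≡-n , u , f≈Pu)
    with leadingTerm (num f) (num≠0 f) | leadingTerm (den f) (den≠0 f)
       | leadingTerm (num u) (num≠0 u) | leadingTerm (den u) (den≠0 u)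
  ... | m₁ , c₁ , h₁ | m₂ , c₂ , h₂ | mₙ , cₙ , hₙ | m_d , c_d , h_d
    with HasLead-unique f≈Pu (HasLead-*ₚ h₁ (HasLead-powₚ h_d q′))
                             (HasLead-*ₚ (HasLead-*ₚ hP h₂) (HasLead-powₚ hₙ q′))
  ... | degrees , coefficients = m₁ , m₂ , c₁ , c₂ , e₀ , h₁ , h₂ , c₁≈gᵉ⁰c₂ , ≡-mod-refl (+ e₀) , degree
    where
    open SetoidReasoning setoid

    degree : (+ m₁ ℤ.- + m₂) ≡ ℤ.- (+ n) [mod q′ ]
    degree = ≡-mod-trans (+ m₁ ℤ.- + m₂) (+ m) (ℤ.- (+ n)) (cancel-degrees m₁ m₂ m mₙ m_d q′ degrees) m≡-n

    c₁≈gᵉ⁰c₂ : c₁ ≈ pow g e₀ * c₂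
    c₁≈gᵉ⁰c₂ = begin
      c₁                               ≈⟨ *-identityʳ c₁ ⟨
      c₁ * 1#                          ≈⟨ *-congˡ (fermat (proj₁ h_d)) ⟨
      c₁ * pow c_d q′                  ≈⟨ coefficients ⟩
      (pow (- 1#) n * c₂) * pow cₙ q′  ≈⟨ *-congˡ (fermat (proj₁ hₙ)) ⟩
      (pow (- 1#) n * c₂) * 1#         ≈⟨ *-identityʳ _ ⟩
      pow (- 1#) n * c₂                ≈⟨ *-congʳ gᵉ⁰≈±1 ⟨
      pow g e₀ * c₂                    ∎

  PhiIs⇒InSpecialSet : ∀ n e₀ → pow g e₀ ≈ pow (- 1#) n → ∀ f → PhiIs q g f (+ e₀) (ℤ.- (+ n)) → InSpecialSet q n f
  -- witnesses: P = num f · (den f)^(q′ − 1) and u = 1 / den f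
  PhiIs⇒InSpecialSet n e₀ gᵉ⁰≈±1 f (m₁ , m₂ , c₁ , c₂ , e , h₁ , h₂ , c₁≈gᵉc₂ , e≡a , m₁-m₂≡-n) =
    N *ₚ powₚ D k , m₁ ℕ.+ k ℕ.* m₂ , P-hasLead , degree , u , f≈Pu
    where
    N = num f
    D = den f
    k = q′ ℕ.∸ 1
    1+k≡q′ : suc k ≡ q′
    1+k≡q′ = ℕ.m+[n∸m]≡n 1≤q′

    gᵉ≉0 : ¬ (pow g e ≈ 0#)
    gᵉ≉0 gᵉ≈0 = proj₁ h₁ (trans c₁≈gᵉc₂ (trans (*-congʳ gᵉ≈0) (zeroˡ _)))

    gᵉ⁰≉0 : ¬ (pow g e₀ ≈ 0#)
    gᵉ⁰≉0 gᵉ⁰≈0 = pow-nonzero n -1≉0 (trans (sym gᵉ⁰≈±1) gᵉ⁰≈0)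

    leadingCoefficient : c₁ * pow c₂ k ≈ pow (- 1#) n
    leadingCoefficient = begin
      c₁ * pow c₂ k               ≈⟨ *-congʳ c₁≈gᵉc₂ ⟩
      (pow g e * c₂) * pow c₂ k   ≈⟨ *-assoc _ _ _ ⟩
      pow g e * pow c₂ (suc k)    ≡⟨ ≡.cong (λ t → pow g e * pow c₂ t) 1+k≡q′ ⟩
      pow g e * pow c₂ q′         ≈⟨ *-congˡ (fermat (proj₁ h₂)) ⟩
      pow g e * 1#                ≈⟨ *-identityʳ _ ⟩
      pow g e                     ≈⟨ pow≉0-cong-mod e e₀ gᵉ≉0 gᵉ⁰≉0 e≡a ⟩
      pow g e₀                    ≈⟨ gᵉ⁰≈±1 ⟩
      pow (- 1#) n                ∎
      where open SetoidReasoning setoid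

    P-hasLead : HasLead (N *ₚ powₚ D k) (m₁ ℕ.+ k ℕ.* m₂) (pow (- 1#) n)
    P-hasLead = HasLead-resp-≈ leadingCoefficient (HasLead-*ₚ h₁ (HasLead-powₚ h₂ k))

    degree : (+ (m₁ ℕ.+ k ℕ.* m₂)) ≡ ℤ.- (+ n) [mod q′ ]
    degree = ≡-mod-trans (+ (m₁ ℕ.+ k ℕ.* m₂)) (+ m₁ ℤ.- + m₂) (ℤ.- (+ n)) (a+[m∸1]b≡a-b m₁ m₂ 1+k≡q′) m₁-m₂≡-n

    u : RatFun
    u = record { num = [ 1# ] ; den = D
               ; num≠0 = HasLead⇒NonZeroPoly (monomial-hasLead 0 1≉0) ; den≠0 = den≠0 f }

    f≈Pu : (N *ₚ powₚ D q′) ≈ₚ ((N *ₚ powₚ D k) *ₚ D *ₚ powₚ [ 1# ] q′)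
    f≈Pu = begin
      N *ₚ powₚ D q′                                ≡⟨ ≡.cong (λ t → N *ₚ powₚ D t) 1+k≡q′ ⟨
      N *ₚ (D *ₚ powₚ D k)                          ≈⟨ *ₚ-congʳ N (*ₚ-comm D (powₚ D k)) ⟩
      N *ₚ (powₚ D k *ₚ D)                          ≈⟨ *ₚ-assoc N (powₚ D k) D ⟨
      (N *ₚ powₚ D k) *ₚ D                          ≈⟨ *ₚ-identityʳ _ ⟨
      (N *ₚ powₚ D k) *ₚ D *ₚ [ 1# ]                ≈⟨ *ₚ-congʳ ((N *ₚ powₚ D k) *ₚ D) (powₚ-one q′) ⟨
      (N *ₚ powₚ D k) *ₚ D *ₚ powₚ [ 1# ] q′        ∎
      where open ≈ₚ-Reasoning

  PhiIs-surjective : ∀ a b → ∃[ f ] PhiIs q g f a b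
  PhiIs-surjective a b with difference-of-naturals b
  ... | m₁ , m₂ , m₁-m₂≡b = f , m₁ , m₂ , pow g e , 1# , e , hN , hD , sym (*-identityʳ _) , e≡a ,
        ≡-mod-reflexive (+ m₁ ℤ.- + m₂) b m₁-m₂≡b
    where
    instance
      q′≢0 : ℕ.NonZero q′
      q′≢0 = ℕ.>-nonZero 1≤q′
    e = a %ℕ q′
    hN : HasLead (monomial m₁ (pow g e)) m₁ (pow g e)
    hN = monomial-hasLead m₁ (pow-g≉0 (n%ℕd<d a q′))
    hD : HasLead (monomial m₂ 1#) m₂ 1#
    hD = monomial-hasLead m₂ 1≉0
    f : RatFun
    f = record { num = monomial m₁ (pow g e) ; den = monomial m₂ 1#
               ; num≠0 = HasLead⇒NonZeroPoly hN ; den≠0 = HasLead⇒NonZeroPoly hD }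
    e≡a : (+ e) ≡ a [mod q′ ]
    e≡a = ≡-mod-sym a (+ e) (≡-mod-by-multiple a (+ e) (a /ℕ q′) (a≡a%ℕn+[a/ℕn]*n a q′))

  characterisation : ∀ n e₀ → pow g e₀ ≈ pow (- 1#) n → ∀ f → InSpecialSet q n f ⇔ PhiIs q g f (+ e₀) (ℤ.- (+ n))
  characterisation n e₀ gᵉ⁰≈±1 f = mk⇔ (InSpecialSet⇒PhiIs n e₀ gᵉ⁰≈±1 f) (PhiIs⇒InSpecialSet n e₀ gᵉ⁰≈±1 f)

  pow-g-[n*half]≈±1 : ∀ h → q′ ≡ h ℕ.* 2 → ∀ n → pow g (n ℕ.* h) ≈ pow (- 1#) n
  pow-g-[n*half]≈±1 h q′≡2h n = begin
    pow g (n ℕ.* h)       ≡⟨ ≡.cong (pow g) (ℕ.*-comm n h) ⟩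
    pow g (h ℕ.* n)       ≈⟨ pow-* g h n ⟨
    pow (pow g h) n       ≈⟨ pow-cong n (pow-g-half≈-1 h q′≡2h) ⟩
    pow (- 1#) n          ∎
    where open SetoidReasoning setoid

  q′-odd⇒1≈[-1]ⁿ : ∀ t → q′ ≡ suc (t ℕ.* 2) → ∀ n → 1# ≈ pow (- 1#) n
  q′-odd⇒1≈[-1]ⁿ t q′≡2t+1 n = sym (trans (pow-cong n (q′-odd⇒-1≈1 t q′≡2t+1)) (pow-one n))

q-odd⇒q′≡[q′/2]*2 : ∀ q′ → suc q′ % 2 ≡ 1 → q′ ≡ (q′ / 2) ℕ.* 2
q-odd⇒q′≡[q′/2]*2 q′ q%2≡1 = ≡.trans q′≡h*2 (≡.cong (ℕ._* 2) (≡.sym q′/2≡h))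
  where
  h = suc q′ / 2
  q′≡h*2 : q′ ≡ h ℕ.* 2
  q′≡h*2 = ℕ.suc-injective (≡.trans (m≡m%n+[m/n]*n (suc q′) 2) (≡.cong (ℕ._+ h ℕ.* 2) q%2≡1))
  q′/2≡h : q′ / 2 ≡ h
  q′/2≡h = ≡.trans (≡.cong (_/ 2) q′≡h*2) (m*n/n≡m h 2)

q-even⇒q′-odd : ∀ q′ → suc q′ % 2 ≡ 0 → ∃[ t ] q′ ≡ suc (t ℕ.* 2)
q-even⇒q′-odd q′ q%2≡0 = halve (suc q′ / 2) q≡h*2
  where
  q≡h*2 : suc q′ ≡ (suc q′ / 2) ℕ.* 2
  q≡h*2 = ≡.trans (m≡m%n+[m/n]*n (suc q′) 2) (≡.cong (ℕ._+ (suc q′ / 2) ℕ.* 2) q%2≡0)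
  halve : ∀ h → suc q′ ≡ h ℕ.* 2 → ∃[ t ] q′ ≡ suc (t ℕ.* 2)
  halve (suc t) q≡2h = t , ℕ.suc-injective q≡2h

open import Data.Nat using (ℕ; _≤_; _*_; _∸_; _%_; _/_)
open import Data.Fin using (Fin)
open import Data.Integer using (ℤ; +_; -_)
open import Data.Product using (_×_; ∃-syntax)
open import Function.Bundles using (Bijection; _⇔_)
open import Relation.Nullary using (¬_)
open import Relation.Binary.PropositionalEquality using (_≡_; setoid)

proposition4p3 :
    (q : ℕ) → IsPrimePower q →
    (F : CommutativeRing 0ℓ 0ℓ) →
    Over.IsField F →
    Bijection (setoid (Fin q)) (CommutativeRing.setoid F) →
    (g : CommutativeRing.Carrier F) →
    (∀ x → ¬ (CommutativeRing._≈_ F x (CommutativeRing.0# F)) → ∃[ e ] CommutativeRing._≈_ F x (Over.pow F g e)) →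
    (n : ℕ) → 1 ≤ n →
    ((q % 2 ≡ 1 → (f : Over.RatFun F) → Over.InSpecialSet F q n f ⇔ Over.PhiIs F q g f (+ (n * ((q ∸ 1) / 2))) (- (+ n)))
    × (q % 2 ≡ 0 → (f : Over.RatFun F) → Over.InSpecialSet F q n f ⇔ Over.PhiIs F q g f (+ 0) (- (+ n)))
    × ((a b : ℤ) → ∃[ f ] Over.PhiIs F q g f a b))
proposition4p3 zero _ F _ B _ _ _ _ = ⊥-elim (Fin.¬Fin0 (proj₁ (Bijection.surjective B (CommutativeRing.0# F))))
proposition4p3 (suc q′) _ F isField B g generates n _ =
  (λ q-odd → characterisation n (n * (q′ / 2)) (pow-g-[n*half]≈±1 (q′ / 2) (q-odd⇒q′≡[q′/2]*2 q′ q-odd) n)) ,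
  (λ q-even → let t , q′≡2t+1 = q-even⇒q′-odd q′ q-even in characterisation n 0 (q′-odd⇒1≈[-1]ⁿ t q′≡2t+1 n)) ,
  PhiIs-surjective
  where open Proposition F isField q′ B g generates
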